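{- Let $C$ be an order-free constraint and let the corresponding soft constraint $C_s(\vec{X},Z)$, defined as $m(\vec{X})\le Z$, be based on an open edit-based violation measure $m$ for $L_C$. Then $C_s$ is contractible, i.e. $C_s(\vec{X}Y,Z)\rightarrow C_s(\vec{X},Z)$ for all $\vec{X}$, $Y$, $Z$.
   Context: A constraint $C$ on sequences of variables is order-free if $C([X_1,\ldots,X_n])\leftrightarrow C([X_{\pi(1)},\ldots,X_{\pi(n)}])$ for every permutation $\pi$ of $1..n$. $L_C$ is the set of words $d_1\cdots d_n$ such that $X_i=d_i$ solves $C([X_1,\ldots,X_n])$, and $P(L)=\{w\mid\exists u\; wu\in L\}$. Given non-negative weights $\alpha,\beta,\gamma,\delta$ for substitution, insertion, deletion, and transposition of two adjacent letters, the open edit-based violation measure for $L$ is $m(w)=\min(\alpha n_s+\beta n_i+\gamma n_d+\delta n_t)$ over all edit sequences transforming $w$ into an element of $P(L)$, with $n_s,n_i,n_d,n_t$ the numbers of each operation.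
   Formalization: The weights α, β, γ, δ and the bound Z are rational. -}

module Defs where

open import Data.List using (List; []; _∷_; _++_; [_])
open import Data.List.Relation.Binary.Permutation.Propositional using (_↭_)
open import Data.Product using (Σ; ∃; _×_; _,_)
open import Data.Maybe using (Maybe; just; nothing)
open import Data.Rational using (ℚ; 0ℚ; _+_; _≤_)
open import Relation.Binary.PropositionalEquality using (_≡_)
open import Relation.Nullary using (¬_)
open import Function.Bundles using (_⇔_)

-- A constraint on sequences of variables over domain D is identified with
-- its set of solutions L_C (a predicate on words).
Constraint : Set → Set₁
Constraint D = List D → Set

OrderFree : {D : Set} → Constraint D → Set
OrderFree {D} C = ∀ (w w′ : List D) → w ↭ w′ → (C w ⇔ C w′)

Prefixes : {D : Set} → (List D → Set) → List D → Set
Prefixes {D} L w = Σ (List D) λ u → L (w ++ u)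

data Op : Set where
  sub ins del tr : Op

data Step {D : Set} : Op → List D → List D → Set where
  substitute : ∀ xs a b ys → Step sub (xs ++ a ∷ ys) (xs ++ b ∷ ys)
  insert     : ∀ xs b ys   → Step ins (xs ++ ys) (xs ++ b ∷ ys)
  delete     : ∀ xs a ys   → Step del (xs ++ a ∷ ys) (xs ++ ys)
  transpose  : ∀ xs a b ys → Step tr (xs ++ a ∷ b ∷ ys) (xs ++ b ∷ a ∷ ys)

data Edits {D : Set} : List D → List D → Set where
  done : ∀ {w} → Edits w w
  step : ∀ {u v w} (o : Op) → Step o u v → Edits v w → Edits u w

record Weights : Set where
  field
    α β γ δ : ℚ

weight : Weights → Op → ℚ
weight W sub = Weights.α W
weight W ins = Weights.β W
weight W del = Weights.γ W
weight W tr  = Weights.δ W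

NonNegWeights : Weights → Set
NonNegWeights W = (0ℚ ≤ Weights.α W) × (0ℚ ≤ Weights.β W)
                × (0ℚ ≤ Weights.γ W) × (0ℚ ≤ Weights.δ W)

cost : {D : Set} → Weights → {u w : List D} → Edits u w → ℚ
cost W done = 0ℚ
cost W (step o _ e) = weight W o + cost W e

-- m is the open edit-based violation measure for L with weights W:
-- m w is the minimum cost of an edit sequence transforming w into an
-- element of P(L); nothing (= +∞) when no such edit sequence exists.
IsOpenEditMeasure : {D : Set} → Weights → (List D → Set) → (List D → Maybe ℚ) → Set
IsOpenEditMeasure {D} W L m = ∀ (w : List D) →
    (∀ (q : ℚ) → m w ≡ just q →
        (Σ (List D) λ v → Prefixes L v × Σ (Edits w v) λ e → cost W e ≡ q)
      × (∀ (v : List D) → Prefixes L v → (e : Edits w v) → q ≤ cost W e))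
  × (m w ≡ nothing → ∀ (v : List D) → Prefixes L v → ¬ Edits w v)

SoftC : {D : Set} → (List D → Maybe ℚ) → List D → ℚ → Set
SoftC m w Z = Σ ℚ λ q → (m w ≡ just q) × (q ≤ Z)

Contractible : {D : Set} → (List D → ℚ → Set) → Set
Contractible {D} Cs = ∀ (w : List D) (y : D) (Z : ℚ) → Cs (w ++ [ y ]) Z → Cs w Z

-- Deleting the last letter y of a word w y is itself an edit, but we must not pay
-- for it.  Instead we push the deletion through an optimal edit sequence from w y to
-- a word v of P(L): each edit either still applies after the deletion or becomes
-- redundant, so w reaches, at no greater cost (weights are non-negative), a word v′
-- obtained from v by deleting at most one letter a.  If v u ∈ L then v′ (a u) is a
-- permutation of v u, hence in L since C is order-free, so v′ ∈ P(L) and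
-- m(w) ≤ m(w y).
module Submission where

open import Defs
open import Data.List using (List; []; _∷_; _++_; [_])
open import Data.Maybe using (Maybe; just; nothing)
open import Data.Rational using (ℚ; 0ℚ; _≤_)
open import Data.Rational.Properties using (≤-trans; ≤-refl; ≤-reflexive; +-mono-≤; +-identityˡ)
open import Data.Product using (Σ; ∃; _×_; _,_; proj₁; proj₂)
open import Data.Sum using (_⊎_; inj₁; inj₂)
open import Data.Empty using (⊥-elim)
open import Relation.Binary.PropositionalEquality using (_≡_; refl; sym)
open import Data.List.Relation.Binary.Permutation.Propositional using (_↭_; prep; ↭-sym)
open import Data.List.Relation.Binary.Permutation.Propositional.Properties using (shift)
open import Function.Bundles using (Equivalence)

weight-nonneg : (W : Weights) → NonNegWeights W → ∀ o → 0ℚ ≤ weight W o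
weight-nonneg W (α≥0 , β≥0 , γ≥0 , δ≥0) sub = α≥0
weight-nonneg W (α≥0 , β≥0 , γ≥0 , δ≥0) ins = β≥0
weight-nonneg W (α≥0 , β≥0 , γ≥0 , δ≥0) del = γ≥0
weight-nonneg W (α≥0 , β≥0 , γ≥0 , δ≥0) tr  = δ≥0

module _ {D : Set} where

  -- Step with its left context xs given letter by letter, so that proofs can
  -- recurse on the position of the edit.
  data StepAt : Op → List D → List D → Set where
    substituteₕ : ∀ a b ys → StepAt sub (a ∷ ys) (b ∷ ys)
    insertₕ     : ∀ b ys   → StepAt ins ys (b ∷ ys)
    deleteₕ     : ∀ a ys   → StepAt del (a ∷ ys) ys
    transposeₕ : ∀ a b ys → StepAt tr (a ∷ b ∷ ys) (b ∷ a ∷ ys)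
    skip       : ∀ {o u v} c → StepAt o u v → StepAt o (c ∷ u) (c ∷ v)

  Step-cons : ∀ {o} {u v : List D} c → Step o u v → Step o (c ∷ u) (c ∷ v)
  Step-cons c (substitute xs a b ys) = substitute (c ∷ xs) a b ys
  Step-cons c (insert xs b ys)       = insert (c ∷ xs) b ys
  Step-cons c (delete xs a ys)       = delete (c ∷ xs) a ys
  Step-cons c (transpose xs a b ys)  = transpose (c ∷ xs) a b ys

  StepAt⇒Step : ∀ {o u v} → StepAt o u v → Step o u v
  StepAt⇒Step (substituteₕ a b ys) = substitute [] a b ys
  StepAt⇒Step (insertₕ b ys)       = insert [] b ys
  StepAt⇒Step (deleteₕ a ys)       = delete [] a ys
  StepAt⇒Step (transposeₕ a b ys)  = transpose [] a b ys
  StepAt⇒Step (skip c s)          = Step-cons c (StepAt⇒Step s)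

  StepAt-skips : ∀ {o} xs {u v} → StepAt o u v → StepAt o (xs ++ u) (xs ++ v)
  StepAt-skips []       s = s
  StepAt-skips (x ∷ xs) s = skip x (StepAt-skips xs s)

  Step⇒StepAt : ∀ {o u v} → Step o u v → StepAt o u v
  Step⇒StepAt (substitute xs a b ys) = StepAt-skips xs (substituteₕ a b ys)
  Step⇒StepAt (insert xs b ys)       = StepAt-skips xs (insertₕ b ys)
  Step⇒StepAt (delete xs a ys)       = StepAt-skips xs (deleteₕ a ys)
  Step⇒StepAt (transpose xs a b ys)  = StepAt-skips xs (transposeₕ a b ys)

  data DropOne : List D → List D → Set where
    here  : ∀ a u → DropOne (a ∷ u) u
    there : ∀ c {u u′} → DropOne u u′ → DropOne (c ∷ u) (c ∷ u′)

  DropAtMostOne : List D → List D → Set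
  DropAtMostOne u u′ = DropOne u u′ ⊎ u ≡ u′

  StepAtMostOnce : Op → List D → List D → Set
  StepAtMostOnce o u v = u ≡ v ⊎ StepAt o u v

  DropAtMostOne-cons : ∀ c {u u′} → DropAtMostOne u u′ → DropAtMostOne (c ∷ u) (c ∷ u′)
  DropAtMostOne-cons c (inj₁ d)    = inj₁ (there c d)
  DropAtMostOne-cons c (inj₂ refl) = inj₂ refl

  StepAtMostOnce-cons : ∀ c {o u v} → StepAtMostOnce o u v → StepAtMostOnce o (c ∷ u) (c ∷ v)
  StepAtMostOnce-cons c (inj₁ refl) = inj₁ refl
  StepAtMostOnce-cons c (inj₂ s)    = inj₂ (skip c s)

  DropOne-commutes-StepAt : ∀ {o u v u′} → StepAt o u v → DropOne u u′ →
    ∃ λ v′ → DropAtMostOne v v′ × StepAtMostOnce o u′ v′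
  DropOne-commutes-StepAt (substituteₕ a b ys) (here _ _) = ys , inj₁ (here b ys) , inj₁ refl
  DropOne-commutes-StepAt (substituteₕ a b ys) (there _ {u′ = ys′} d) =
    b ∷ ys′ , inj₁ (there b d) , inj₂ (substituteₕ a b ys′)
  DropOne-commutes-StepAt {u′ = u′} (insertₕ b ys) d = b ∷ u′ , inj₁ (there b d) , inj₂ (insertₕ b u′)
  DropOne-commutes-StepAt (deleteₕ a ys) (here _ _) = ys , inj₂ refl , inj₁ refl
  DropOne-commutes-StepAt (deleteₕ a ys) (there _ {u′ = ys′} d) = ys′ , inj₁ d , inj₂ (deleteₕ a ys′)
  DropOne-commutes-StepAt (transposeₕ a b ys) (here _ _) =
    b ∷ ys , inj₁ (there b (here a ys)) , inj₁ refl
  DropOne-commutes-StepAt (transposeₕ a b ys) (there _ (here _ _)) =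
    a ∷ ys , inj₁ (here b (a ∷ ys)) , inj₁ refl
  DropOne-commutes-StepAt (transposeₕ a b ys) (there _ (there _ {u′ = ys′} d)) =
    b ∷ a ∷ ys′ , inj₁ (there b (there a d)) , inj₂ (transposeₕ a b ys′)
  DropOne-commutes-StepAt (skip c s) (here _ _) = _ , inj₁ (here c _) , inj₂ s
  DropOne-commutes-StepAt (skip c s) (there _ d) with DropOne-commutes-StepAt s d
  ... | v′ , d′ , s′ = c ∷ v′ , DropAtMostOne-cons c d′ , StepAtMostOnce-cons c s′

  DropAtMostOne-commutes-Step : ∀ {o u v u′} → Step o u v → DropAtMostOne u u′ →
    ∃ λ v′ → DropAtMostOne v v′ × StepAtMostOnce o u′ v′
  DropAtMostOne-commutes-Step s (inj₁ d)        = DropOne-commutes-StepAt (Step⇒StepAt s) d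
  DropAtMostOne-commutes-Step {v = v} s (inj₂ refl) = v , inj₂ refl , inj₂ (Step⇒StepAt s)

  Edits-DropAtMostOne : (W : Weights) → NonNegWeights W →
    ∀ {u w u′} (e : Edits u w) → DropAtMostOne u u′ →
    ∃ λ w′ → DropAtMostOne w w′ × Σ (Edits u′ w′) λ e′ → cost W e′ ≤ cost W e
  Edits-DropAtMostOne W nn done d = _ , d , done , ≤-refl
  Edits-DropAtMostOne W nn (step o s e) d with DropAtMostOne-commutes-Step s d
  ... | v′ , d′ , s′ with Edits-DropAtMostOne W nn e d′
  ... | w′ , dw , e′ , e′≤e with s′
  ... | inj₁ refl = w′ , dw , e′ ,
          ≤-trans (≤-reflexive (sym (+-identityˡ _))) (+-mono-≤ (weight-nonneg W nn o) e′≤e)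
  ... | inj₂ t    = w′ , dw , step o (StepAt⇒Step t) e′ , +-mono-≤ (≤-refl {weight W o}) e′≤e

  DropOne-snoc : ∀ w y → DropOne (w ++ [ y ]) w
  DropOne-snoc []      y = here y []
  DropOne-snoc (x ∷ w) y = there x (DropOne-snoc w y)

  DropOne-↭ : ∀ {v v′} → DropOne v v′ → ∃ λ a → ∀ u → (v ++ u) ↭ (v′ ++ a ∷ u)
  DropOne-↭ (here a v) = a , λ u → ↭-sym (shift a v u)
  DropOne-↭ (there c d) with DropOne-↭ d
  ... | a , v↭ = a , λ u → prep c (v↭ u)

Prefixes-DropAtMostOne : {D : Set} (C : Constraint D) → OrderFree C →
  ∀ {v v′} → DropAtMostOne v v′ → Prefixes C v → Prefixes C v′
Prefixes-DropAtMostOne C of (inj₂ refl) p = p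
Prefixes-DropAtMostOne C of (inj₁ d) (u , vu∈C) with DropOne-↭ d
... | a , v↭ = a ∷ u , Equivalence.to (of _ _ (v↭ u)) vu∈C

SoftC-from-Edits : {D : Set} (W : Weights) (L : List D → Set) (m : List D → Maybe ℚ) →
  IsOpenEditMeasure W L m → ∀ {w v} Z → Prefixes L v → (e : Edits w v) → cost W e ≤ Z →
  SoftC m w Z
SoftC-from-Edits W L m isM {w} {v} Z v∈PL e e≤Z with m w in mw
... | just q  = q , refl , ≤-trans (proj₂ (proj₁ (isM w) q mw) v v∈PL e) e≤Z
... | nothing = ⊥-elim (proj₂ (isM w) mw v v∈PL e)

corollary3 : {D : Set} (C : Constraint D) (W : Weights) (m : List D → Maybe ℚ) →
    OrderFree C → NonNegWeights W → IsOpenEditMeasure W C m →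
    Contractible (SoftC m)
corollary3 C W m of nn isM w y Z (q , mwy , q≤Z)
  with proj₁ (proj₁ (isM (w ++ [ y ])) q mwy)
... | v , v∈PC , e , cost≡q
  with Edits-DropAtMostOne W nn e (inj₁ (DropOne-snoc w y))
... | v′ , d , e′ , e′≤e =
  SoftC-from-Edits W C m isM Z (Prefixes-DropAtMostOne C of d v∈PC) e′
    (≤-trans e′≤e (≤-trans (≤-reflexive cost≡q) q≤Z))
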